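{- There exists a class $\mathcal{C}$ of graphs of bounded expansion such that for every $k\in\mathbb{N}$ there is $G\in\mathcal{C}$ such that every $k$-domination core of $G$ has $\Omega(k^2)$ vertices.
   Context: $Z\subseteq V(G)$ is a $k$-domination core if every set of size at most $k$ that dominates $Z$ also dominates $V(G)$. A graph $M$ is an $r$-shallow minor of $G$ if there are disjoint connected vertex sets $V_1,\dots,V_{|M|}$ of $G$, each inducing a subgraph of radius at most $r$, and a bijection $\omega$ from $V(M)$ to these sets such that each edge $uv$ of $M$ corresponds to an edge of $G$ between $\omega(u)$ and $\omega(v)$. A class $\mathcal{C}$ has bounded expansion if there is $f:\mathbb{N}\to\mathbb{R}$ such that for all $r$ and all $G\in\mathcal{C}$, every $r$-shallow minor $M$ of $G$ satisfies $|E(M)|/|V(M)|\le f(r)$. -}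

module Defs where

open import Data.Nat using (ℕ; zero; suc; _+_; _*_; _≤_; _<ᵇ_)
open import Data.Bool using (Bool; true; false; _∧_; if_then_else_)
open import Data.Fin using (Fin; toℕ)
open import Data.Fin.Subset using (Subset; _∈_; _∉_; ∣_∣; ⊤)
open import Data.Product using (Σ; ∃; ∃-syntax; _×_)
open import Data.Sum using (_⊎_)
open import Relation.Binary.PropositionalEquality using (_≡_)
open import Relation.Nullary using (¬_)

record Graph : Set where
  field
    size  : ℕ
    adj   : Fin size → Fin size → Bool
    sym   : ∀ u v → adj u v ≡ adj v u
    irrefl : ∀ u → adj u u ≡ false
open Graph public

V : Graph → Set
V G = Fin (size G)

Adj : (G : Graph) → V G → V G → Set
Adj G u v = adj G u v ≡ true

countTrue : ∀ {n} → (Fin n → Bool) → ℕ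
countTrue {zero} f = 0
countTrue {suc n} f = (if f Fin.zero then 1 else 0) + countTrue (λ i → f (Fin.suc i))

sumFin : ∀ {n} → (Fin n → ℕ) → ℕ
sumFin {zero} f = 0
sumFin {suc n} f = f Fin.zero + sumFin (λ i → f (Fin.suc i))

numEdges : Graph → ℕ
numEdges G = sumFin (λ i → countTrue (λ j → (toℕ i <ᵇ toℕ j) ∧ adj G i j))

numVertices : Graph → ℕ
numVertices G = size G

Dominates : (G : Graph) → Subset (size G) → Subset (size G) → Set
Dominates G D Z = ∀ z → z ∈ Z → z ∈ D ⊎ (∃[ d ] (d ∈ D × Adj G d z))

IsDominationCore : (G : Graph) → ℕ → Subset (size G) → Set
IsDominationCore G k Z =
  ∀ (D : Subset (size G)) → ∣ D ∣ ≤ k → Dominates G D Z → Dominates G D ⊤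

-- ReachIn G S r c v : there is a walk from c to v of length ≤ r in G,
-- all of whose vertices after c lie in S (used with c ∈ S, i.e. a walk in G[S])
data ReachIn (G : Graph) (S : Subset (size G)) : ℕ → V G → V G → Set where
  here : ∀ {r v} → ReachIn G S r v v
  step : ∀ {r u w v} → Adj G u w → w ∈ S → ReachIn G S r w v → ReachIn G S (suc r) u v

-- G[S] has radius at most r (S nonempty, some centre reaches all of S within r steps in G[S];
-- this implies G[S] is connected)
RadiusAtMost : (G : Graph) → Subset (size G) → ℕ → Set
RadiusAtMost G S r = ∃[ c ] (c ∈ S × (∀ v → v ∈ S → ReachIn G S r c v))

record ShallowMinor (r : ℕ) (M G : Graph) : Set where
  field
    ω        : V M → Subset (size G)
    disjoint : ∀ a b → ¬ (a ≡ b) → ∀ x → x ∈ ω a → x ∉ ω b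
    radius   : ∀ a → RadiusAtMost G (ω a) r
    edges    : ∀ a b → Adj M a b → ∃[ x ] ∃[ y ] (x ∈ ω a × y ∈ ω b × Adj G x y)

GraphClass : Set₁
GraphClass = Graph → Set

-- Bounded expansion: |E(M)|/|V(M)| ≤ f(r), written multiplicatively (f may be taken ℕ-valued
-- by rounding up a real bound).
BoundedExpansion : GraphClass → Set
BoundedExpansion 𝒞 =
  Σ (ℕ → ℕ) λ f → (∀ (r : ℕ) (G : Graph) → 𝒞 G → ∀ (M : Graph) → ShallowMinor r M G →
          numEdges M ≤ f r * numVertices M)

-- Star forests (every edge has an endpoint of degree one) are closed under shallow minors: a
-- pendant vertex has no neighbour in its own branch set, so by the radius bound it is the whole
-- branch set, and its branch vertex is pendant in the minor.  A star forest on n vertices has at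
-- most 2n edges, so the class has bounded expansion.  Now take m disjoint stars with ℓ + 2
-- leaves each, where m + ℓ ≤ k.  If Z contains at most ℓ of the last ℓ + 1 leaves of some star,
-- then the other m − 1 centres, the first leaf of that star and its leaves in Z form a set of at
-- most k vertices that dominates Z but misses a leaf.  Hence a k-domination core has at least
-- ℓ + 1 vertices in every star, i.e. at least m(ℓ + 1) ≥ k²/4 for m = ⌈k/2⌉ and ℓ = ⌊k/2⌋.
module Submission where

open import Defs hiding (sym)

open import Data.Bool.Base using (Bool; true; false; _∧_; if_then_else_)
open import Data.Fin.Base using (Fin; zero; suc; toℕ; combine; remQuot; punchIn; _↑ˡ_; _↑ʳ_)
open import Data.Fin.Properties using (_≟_; combine-remQuot; remQuot-combine; punchInᵢ≢i; all?; ¬∀⟶∃¬)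
open import Data.Fin.Subset using (Subset; _∈_; _∉_; _⊆_; ⊤; ⁅_⁆; ∣_∣; inside; outside)
open import Data.Fin.Subset.Properties
  using (_∈?_; ∈⊤; x∈⁅x⁆; ∣⊤∣≡n; ∣⁅x⁆∣≡1; ∣p∣≤∣x∷p∣; p⊆q⇒∣p∣≤∣q∣; drop-there)
open import Data.Nat.Base using (ℕ; zero; suc; _+_; _*_; _≤_; _≥_; _<_; _<ᵇ_; z≤n; s≤s; ⌊_/2⌋; ⌈_/2⌉)
open import Data.Nat.Properties hiding (_≟_)
open import Algebra.Properties.CommutativeMonoid.Sum +-0-commutativeMonoid
  using (sum-syntax; sum-cong-≗; sum-replicate-zero; ∑-distrib-+; ∑-comm; sum-remove)
open import Data.Nat.Tactic.RingSolver using (solve-∀)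
open import Data.Product.Base using (_×_; _,_; ∃-syntax)
open import Data.Sum.Base as Sum using (_⊎_; inj₁; inj₂)
open import Data.Vec.Base using ([]; _∷_; lookup; tabulate; concat; here; there)
open import Data.Vec.Properties
  using (lookup∘tabulate; tabulate∘lookup; tabulate-cong; lookup-concat; []=⇒lookup; lookup⇒[]=)
open import Function.Base using (_∘_)
open import Relation.Binary.PropositionalEquality
  using (_≡_; _≢_; refl; sym; trans; cong; cong₂; subst; module ≡-Reasoning)
open import Relation.Nullary using (¬_; Dec; yes; no; does; contradiction)
open import Relation.Nullary.Decidable using (dec-true; dec-false; decidable-stable)

[_] : Bool → ℕ
[ b ] = if b then 1 else 0

∑-mono-≤ : ∀ {n} {f g : Fin n → ℕ} → (∀ i → f i ≤ g i) → ∑[ i < n ] f i ≤ ∑[ i < n ] g i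
∑-mono-≤ {zero}  _   = z≤n
∑-mono-≤ {suc n} f≤g = +-mono-≤ (f≤g zero) (∑-mono-≤ (f≤g ∘ suc))

∑-const : ∀ n c → ∑[ i < n ] c ≡ n * c
∑-const zero    c = refl
∑-const (suc n) c = cong (c +_) (∑-const n c)

∑-↑ : ∀ m {n} (f : Fin (m + n) → ℕ) →
      ∑[ v < m + n ] f v ≡ ∑[ i < m ] f (i ↑ˡ n) + ∑[ j < n ] f (m ↑ʳ j)
∑-↑ zero    f = refl
∑-↑ (suc m) f = trans (cong (f zero +_) (∑-↑ m (f ∘ suc))) (sym (+-assoc (f zero) _ _))

∑-combine : ∀ m {n} (f : Fin (m * n) → ℕ) →
            ∑[ v < m * n ] f v ≡ ∑[ i < m ] ∑[ j < n ] f (combine i j)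
∑-combine zero        f = refl
∑-combine (suc m) {n} f =
  trans (∑-↑ n {m * n} f) (cong (∑[ j < n ] f (j ↑ˡ (m * n)) +_) (∑-combine m (f ∘ (n ↑ʳ_))))

sumFin≡∑ : ∀ {n} (f : Fin n → ℕ) → sumFin f ≡ ∑[ i < n ] f i
sumFin≡∑ {zero}  f = refl
sumFin≡∑ {suc n} f = cong (f zero +_) (sumFin≡∑ (f ∘ suc))

countTrue≡∑ : ∀ {n} (f : Fin n → Bool) → countTrue f ≡ ∑[ i < n ] [ f i ]
countTrue≡∑ {zero}  f = refl
countTrue≡∑ {suc n} f = cong ([ f zero ] +_) (countTrue≡∑ (f ∘ suc))

∣p∣≡∑ : ∀ {n} (p : Subset n) → ∣ p ∣ ≡ ∑[ i < n ] [ lookup p i ]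
∣p∣≡∑ []            = refl
∣p∣≡∑ (outside ∷ p) = ∣p∣≡∑ p
∣p∣≡∑ (inside  ∷ p) = cong suc (∣p∣≡∑ p)

∣tabulate∣≡countTrue : ∀ {n} (f : Fin n → Bool) → ∣ tabulate f ∣ ≡ countTrue f
∣tabulate∣≡countTrue f =
  trans (∣p∣≡∑ (tabulate f)) (trans (sum-cong-≗ (cong [_] ∘ lookup∘tabulate f)) (sym (countTrue≡∑ f)))

countTrue≤1 : ∀ {n} {f : Fin n → Bool} (v : Fin n) → (∀ w → f w ≡ true → w ≡ v) → countTrue f ≤ 1
countTrue≤1 {f = f} v only-v = begin
  countTrue f      ≡⟨ sym (∣tabulate∣≡countTrue f) ⟩
  ∣ tabulate f ∣   ≤⟨ p⊆q⇒∣p∣≤∣q∣ tabulate⊆⁅v⁆ ⟩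
  ∣ ⁅ v ⁆ ∣        ≡⟨ ∣⁅x⁆∣≡1 v ⟩
  1                ∎
  where
  open ≤-Reasoning
  tabulate⊆⁅v⁆ : tabulate f ⊆ ⁅ v ⁆
  tabulate⊆⁅v⁆ {w} w∈ =
    subst (_∈ ⁅ v ⁆) (sym (only-v w (trans (sym (lookup∘tabulate f w)) ([]=⇒lookup w∈)))) (x∈⁅x⁆ v)

∣p∣<n⇒∃∉ : ∀ {n} (p : Subset n) → ∣ p ∣ < n → ∃[ j ] j ∉ p
∣p∣<n⇒∃∉ {n} p ∣p∣<n = ¬∀⟶∃¬ n (_∈ p) (_∈? p) λ all∈p →
  <⇒≱ ∣p∣<n (subst (_≤ ∣ p ∣) (∣⊤∣≡n n) (p⊆q⇒∣p∣≤∣q∣ {p = ⊤} (λ {x} _ → all∈p x)))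

∈-by-lookup : ∀ {m n} {x : Fin m} {y : Fin n} {p : Subset m} {q : Subset n} →
              lookup p x ≡ lookup q y → x ∈ p → y ∈ q
∈-by-lookup {y = y} {q = q} eq x∈p = lookup⇒[]= y q (trans (sym eq) ([]=⇒lookup x∈p))

row : ∀ {m n} → Subset (m * n) → Fin m → Subset n
row p i = tabulate (λ j → lookup p (combine i j))

∣p∣≡∑∣row∣ : ∀ m {n} (p : Subset (m * n)) → ∣ p ∣ ≡ ∑[ i < m ] ∣ row p i ∣
∣p∣≡∑∣row∣ m {n} p = begin
  ∣ p ∣                                            ≡⟨ ∣p∣≡∑ p ⟩
  ∑[ v < m * n ] [ lookup p v ]                    ≡⟨ ∑-combine m (λ v → [ lookup p v ]) ⟩
  ∑[ i < m ] ∑[ j < n ] [ lookup p (combine i j) ]  ≡⟨ sum-cong-≗ (λ i → sym (∣row∣≡∑ i)) ⟩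
  ∑[ i < m ] ∣ row p i ∣                            ∎
  where
  open ≡-Reasoning
  ∣row∣≡∑ : ∀ (i : Fin m) → ∣ row p i ∣ ≡ ∑[ j < n ] [ lookup p (combine i j) ]
  ∣row∣≡∑ i = trans (∣tabulate∣≡countTrue f) (countTrue≡∑ f)
    where f = λ j → lookup p (combine i j)

fromRows : ∀ {m n} → (Fin m → Subset n) → Subset (m * n)
fromRows R = concat (tabulate R)

lookup-fromRows : ∀ {m n} (R : Fin m → Subset n) i j →
                  lookup (fromRows R) (combine i j) ≡ lookup (R i) j
lookup-fromRows R i j =
  trans (lookup-concat (tabulate R) i j) (cong (λ q → lookup q j) (lookup∘tabulate R i))

∣fromRows∣ : ∀ m {n} (R : Fin m → Subset n) → ∣ fromRows R ∣ ≡ ∑[ i < m ] ∣ R i ∣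
∣fromRows∣ m R = trans (∣p∣≡∑∣row∣ m (fromRows R)) (sum-cong-≗ (cong ∣_∣ ∘ row-fromRows))
  where
  row-fromRows : ∀ i → row (fromRows R) i ≡ R i
  row-fromRows i = trans (tabulate-cong (lookup-fromRows R i)) (tabulate∘lookup (R i))

-- Star forests have bounded expansion

Adj-sym : ∀ {G : Graph} {u v} → Adj G u v → Adj G v u
Adj-sym {G} {u} {v} u~v = trans (Graph.sym G v u) u~v

Adj⇒≢ : ∀ {G : Graph} {u v} → Adj G u v → u ≢ v
Adj⇒≢ {G} {u} u~u refl = contradiction (trans (sym u~u) (irrefl G u)) λ ()

Pendant : (G : Graph) → V G → V G → Set
Pendant G u v = ∀ w → Adj G u w → w ≡ v

StarForest : GraphClass
StarForest G = ∀ u v → Adj G u v → Pendant G u v ⊎ Pendant G v u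

module _ (G : Graph) (S : Subset (size G)) {x : V G} (x-isolated : ∀ w → Adj G x w → w ∉ S) where

  reach-from-isolated : ∀ {r z} → ReachIn G S r x z → z ≡ x
  reach-from-isolated here             = refl
  reach-from-isolated (step x~w w∈S _) = contradiction w∈S (x-isolated _ x~w)

  reach-to-isolated : ∀ {r c} → c ∈ S → ReachIn G S r c x → c ≡ x
  reach-to-isolated _   here                = refl
  reach-to-isolated c∈S (step c~w w∈S w⇝x) with reach-to-isolated w∈S w⇝x
  ... | refl = contradiction c∈S (x-isolated _ (Adj-sym {G} c~w))

  isolated⇒singleton : ∀ {r} → RadiusAtMost G S r → x ∈ S → ∀ y → y ∈ S → y ≡ x
  isolated⇒singleton (c , c∈S , reach) x∈S y y∈S with reach-to-isolated c∈S (reach x x∈S)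
  ... | refl = reach-from-isolated (reach y y∈S)

module _ {r : ℕ} {M G : Graph} (μ : ShallowMinor r M G) where
  open ShallowMinor μ

  -- x is alone in ω a, so every edge leaving ω a starts at x and ends at y ∈ ω b.
  pendant-branch : ∀ {a b x y} → a ≢ b → x ∈ ω a → y ∈ ω b → Pendant G x y → Pendant M a b
  pendant-branch {a} {b} {x} {y} a≢b x∈a y∈b x↦y b′ a~b′ with edges a b′ a~b′
  ... | x′ , y′ , x′∈a , y′∈b′ , x′~y′ =
    decidable-stable (b′ ≟ b) λ b′≢b → disjoint b′ b b′≢b y y∈b′ y∈b
    where
    x-isolated : ∀ w → Adj G x w → w ∉ ω a
    x-isolated w x~w = disjoint b a (a≢b ∘ sym) w (subst (_∈ ω b) (sym (x↦y w x~w)) y∈b)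
    x′≡x : x′ ≡ x
    x′≡x = isolated⇒singleton G (ω a) x-isolated (radius a) x∈a x′ x′∈a
    y∈b′ : y ∈ ω b′
    y∈b′ = subst (_∈ ω b′) (x↦y y′ (subst (λ z → Adj G z y′) x′≡x x′~y′)) y′∈b′

  starForest-minorClosed : StarForest G → StarForest M
  starForest-minorClosed forest a b a~b with edges a b a~b
  ... | x , y , x∈a , y∈b , x~y =
    Sum.map (pendant-branch a≢b x∈a y∈b) (pendant-branch (a≢b ∘ sym) y∈b x∈a) (forest x y x~y)
    where a≢b = Adj⇒≢ {M} a~b

degree : (G : Graph) → V G → ℕ
degree G u = countTrue (adj G u)

pendant⇒degree≤1 : ∀ {G : Graph} {u v} → Pendant G u v → degree G u ≤ 1
pendant⇒degree≤1 {v = v} u↦v = countTrue≤1 v u↦v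

numEdges≡∑ : ∀ (G : Graph) →
             numEdges G ≡ ∑[ u < size G ] ∑[ v < size G ] [ (toℕ u <ᵇ toℕ v) ∧ adj G u v ]
numEdges≡∑ G =
  trans (sumFin≡∑ (λ u → countTrue (edgesAfter u))) (sum-cong-≗ (countTrue≡∑ ∘ edgesAfter))
  where
  edgesAfter : V G → V G → Bool
  edgesAfter u v = (toℕ u <ᵇ toℕ v) ∧ adj G u v

[∧]≤[∧]+[∧] : ∀ b e {l l′} → (e ≡ true → l ≡ true ⊎ l′ ≡ true) → [ b ∧ e ] ≤ [ l ∧ e ] + [ l′ ∧ e ]
[∧]≤[∧]+[∧] false _     _ = z≤n
[∧]≤[∧]+[∧] true  false _ = z≤n
[∧]≤[∧]+[∧] true  true  l∨l′ with l∨l′ refl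
... | inj₁ refl = s≤s z≤n
... | inj₂ refl = m≤n+m 1 _

-- Charge every edge to an endpoint of degree at most one; each vertex pays at most one.
module _ (M : Graph) (forest : StarForest M) where
  private
    n = size M

  isLeaf : V M → Bool
  isLeaf u = does (degree M u ≤? 1)

  leafCharge : V M → V M → ℕ
  leafCharge u v = [ isLeaf u ∧ adj M u v ]

  leafCharge-row : ∀ u → ∑[ v < n ] leafCharge u v ≤ 1
  leafCharge-row u = bound (degree M u ≤? 1)
    where
    bound : (d : Dec (degree M u ≤ 1)) → ∑[ v < n ] [ does d ∧ adj M u v ] ≤ 1
    bound (yes deg≤1) = subst (_≤ 1) (countTrue≡∑ (adj M u)) deg≤1
    bound (no _)      = subst (_≤ 1) (sym (sum-replicate-zero n)) z≤n

  edge≤leafCharges : ∀ u v → [ (toℕ u <ᵇ toℕ v) ∧ adj M u v ] ≤ leafCharge u v + leafCharge v u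
  edge≤leafCharges u v =
    subst (λ e → [ (toℕ u <ᵇ toℕ v) ∧ adj M u v ] ≤ leafCharge u v + [ isLeaf v ∧ e ])
          (Graph.sym M u v)
          ([∧]≤[∧]+[∧] _ _ λ u~v → Sum.map pendant⇒isLeaf pendant⇒isLeaf (forest u v u~v))
    where
    pendant⇒isLeaf : ∀ {x y} → Pendant M x y → isLeaf x ≡ true
    pendant⇒isLeaf x↦y = dec-true (_ ≤? 1) (pendant⇒degree≤1 {M} x↦y)

  numEdges≤2*size : numEdges M ≤ 2 * n
  numEdges≤2*size = begin
    numEdges M
      ≡⟨ numEdges≡∑ M ⟩
    ∑[ u < n ] ∑[ v < n ] [ (toℕ u <ᵇ toℕ v) ∧ adj M u v ]
      ≤⟨ ∑-mono-≤ (λ u → ∑-mono-≤ (edge≤leafCharges u)) ⟩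
    ∑[ u < n ] ∑[ v < n ] (leafCharge u v + leafCharge v u)
      ≡⟨ sum-cong-≗ (λ u → ∑-distrib-+ (leafCharge u) (λ v → leafCharge v u)) ⟩
    ∑[ u < n ] (∑[ v < n ] leafCharge u v + ∑[ v < n ] leafCharge v u)
      ≡⟨ ∑-distrib-+ (λ u → ∑[ v < n ] leafCharge u v) (λ u → ∑[ v < n ] leafCharge v u) ⟩
    total + ∑[ u < n ] ∑[ v < n ] leafCharge v u
      ≡⟨ cong (total +_) (∑-comm (λ u v → leafCharge v u)) ⟩
    total + total
      ≤⟨ +-mono-≤ total≤n total≤n ⟩
    n + n
      ≡⟨ cong (n +_) (sym (+-identityʳ n)) ⟩
    2 * n ∎
    where
    open ≤-Reasoning
    total = ∑[ u < n ] ∑[ v < n ] leafCharge u v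
    total≤n : total ≤ n
    total≤n = ≤-trans (∑-mono-≤ leafCharge-row) (≤-reflexive (trans (∑-const n 1) (*-identityʳ n)))

starForest-boundedExpansion : BoundedExpansion StarForest
starForest-boundedExpansion =
  (λ _ → 2) , λ _ _ forest M μ → numEdges≤2*size M (starForest-minorClosed μ forest)

does-≟-sym : ∀ {m} (i j : Fin m) → does (i ≟ j) ≡ does (j ≟ i)
does-≟-sym i j with i ≟ j
... | yes refl = sym (dec-true (i ≟ i) refl)
... | no  i≢j  = sym (dec-false (j ≟ i) (i≢j ∘ sym))

does-≟⇒≡ : ∀ {m} {i j : Fin m} → does (i ≟ j) ≡ true → i ≡ j
does-≟⇒≡ {i = i} {j} eq =
  decidable-stable (i ≟ j) λ i≢j → contradiction (trans (sym eq) (dec-false (i ≟ j) i≢j)) λ ()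

-- Cell (i , 0) is the centre of star i, cells (i , suc a) are its leaves.
starAdj : ∀ {m k} → Fin m × Fin k → Fin m × Fin k → Bool
starAdj (i , zero)  (i′ , suc _) = does (i ≟ i′)
starAdj (i , suc _) (i′ , zero)  = does (i ≟ i′)
starAdj _           _            = false

starAdj-sym : ∀ {m k} (x y : Fin m × Fin k) → starAdj x y ≡ starAdj y x
starAdj-sym (i , zero)  (i′ , zero)  = refl
starAdj-sym (i , zero)  (i′ , suc _) = does-≟-sym i i′
starAdj-sym (i , suc _) (i′ , zero)  = does-≟-sym i i′
starAdj-sym (i , suc _) (i′ , suc _) = refl

starAdj-irrefl : ∀ {m k} (x : Fin m × Fin k) → starAdj x x ≡ false
starAdj-irrefl (i , zero)  = refl
starAdj-irrefl (i , suc _) = refl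

Stars : ℕ → ℕ → Graph
Stars m n = record
  { size   = m * suc n
  ; adj    = λ u v → starAdj (remQuot {m} (suc n) u) (remQuot {m} (suc n) v)
  ; sym    = λ u v → starAdj-sym (remQuot {m} (suc n) u) (remQuot {m} (suc n) v)
  ; irrefl = λ u → starAdj-irrefl (remQuot {m} (suc n) u)
  }

data Cell {m n : ℕ} : Fin (m * n) → Set where
  cell : ∀ (i : Fin m) (j : Fin n) → Cell (combine i j)

cellOf : ∀ {m} n (u : Fin (m * n)) → Cell {m} {n} u
cellOf {m} n u = subst (Cell {m} {n}) (combine-remQuot {m} n u) (cell _ _)

module _ {m n : ℕ} where

  adj-combine : ∀ (i : Fin m) a (i′ : Fin m) b →
                adj (Stars m n) (combine i a) (combine i′ b) ≡ starAdj (i , a) (i′ , b)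
  adj-combine i a i′ b = cong₂ starAdj (remQuot-combine i a) (remQuot-combine i′ b)

  centre~leaf : ∀ (i : Fin m) (a : Fin n) → Adj (Stars m n) (combine i zero) (combine i (suc a))
  centre~leaf i a = trans (adj-combine i zero i (suc a)) (dec-true (i ≟ i) refl)

  leaf~centre : ∀ (i : Fin m) (a : Fin n) → Adj (Stars m n) (combine i (suc a)) (combine i zero)
  leaf~centre i a = Adj-sym {Stars m n} (centre~leaf i a)

  leaf-neighbour : ∀ {i : Fin m} {a : Fin n} {w} →
                   Adj (Stars m n) (combine i (suc a)) w → w ≡ combine i zero
  leaf-neighbour {i} {a} {w} leaf~w with cellOf {m} (suc n) w
  ... | cell i′ zero    = cong (λ c → combine c zero) (sym (does-≟⇒≡ {i = i} {i′} i≟i′))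
    where i≟i′ = trans (sym (adj-combine i (suc a) i′ zero)) leaf~w
  ... | cell i′ (suc b) = contradiction (trans (sym leaf~w) (adj-combine i (suc a) i′ (suc b))) λ ()

  leaf-pendant : ∀ {i : Fin m} {a : Fin n} {v} →
                 Adj (Stars m n) (combine i (suc a)) v → Pendant (Stars m n) (combine i (suc a)) v
  leaf-pendant leaf~v w leaf~w = trans (leaf-neighbour leaf~w) (sym (leaf-neighbour leaf~v))

  stars-starForest : StarForest (Stars m n)
  stars-starForest u v u~v with cellOf {m} (suc n) u | cellOf {m} (suc n) v
  ... | cell i (suc a) | _              = inj₁ (leaf-pendant u~v)
  ... | cell i zero    | cell i′ (suc b) = inj₂ (leaf-pendant (Adj-sym {Stars m n} u~v))
  ... | cell i zero    | cell i′ zero    = contradiction (trans (sym u~v) (adj-combine i zero i′ zero)) λ ()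

-- Domination cores of disjoint unions of stars

laterLeaves : ∀ {m ℓ} → Subset (size (Stars m (2 + ℓ))) → Fin m → Subset (suc ℓ)
laterLeaves Z i = tabulate (λ j → lookup Z (combine i (suc (suc j))))

∣laterLeaves∣≤∣row∣ : ∀ {m ℓ} (Z : Subset (size (Stars m (2 + ℓ)))) (i : Fin m) →
                      ∣ laterLeaves {m} {ℓ} Z i ∣ ≤ ∣ row {m} Z i ∣
∣laterLeaves∣≤∣row∣ Z i = ≤-trans (∣p∣≤∣x∷p∣ z₁ (laterLeaves Z i)) (∣p∣≤∣x∷p∣ z₀ (z₁ ∷ laterLeaves Z i))
  where
  z₀ = lookup Z (combine i zero)
  z₁ = lookup Z (combine i (suc zero))

module BadStar {m ℓ : ℕ} (Z : Subset (size (Stars (suc m) (2 + ℓ)))) (i₀ : Fin (suc m)) where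
  private
    G = Stars (suc m) (2 + ℓ)
    p = laterLeaves Z i₀

  starRow : Fin (suc m) → Subset (3 + ℓ)
  starRow i = if does (i ≟ i₀) then outside ∷ inside ∷ p else ⁅ zero ⁆

  starRow-i₀ : starRow i₀ ≡ outside ∷ inside ∷ p
  starRow-i₀ = cong (if_then outside ∷ inside ∷ p else ⁅ zero ⁆) (dec-true (i₀ ≟ i₀) refl)

  starRow-other : ∀ {i} → i ≢ i₀ → starRow i ≡ ⁅ zero ⁆
  starRow-other {i} i≢i₀ = cong (if_then outside ∷ inside ∷ p else ⁅ zero ⁆) (dec-false (i ≟ i₀) i≢i₀)

  D : Subset (size G)
  D = fromRows starRow

  ∣D∣ : ∣ D ∣ ≡ suc ∣ p ∣ + m
  ∣D∣ = begin
    ∣ D ∣                                                  ≡⟨ ∣fromRows∣ (suc m) starRow ⟩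
    ∑[ i < suc m ] ∣ starRow i ∣                            ≡⟨ sum-remove {i = i₀} (∣_∣ ∘ starRow) ⟩
    ∣ starRow i₀ ∣ + ∑[ j < m ] ∣ starRow (punchIn i₀ j) ∣  ≡⟨ cong₂ _+_ (cong ∣_∣ starRow-i₀) ∑others ⟩
    suc ∣ p ∣ + m                                          ∎
    where
    open ≡-Reasoning
    ∑others : ∑[ j < m ] ∣ starRow (punchIn i₀ j) ∣ ≡ m
    ∑others = begin
      ∑[ j < m ] ∣ starRow (punchIn i₀ j) ∣
        ≡⟨ sum-cong-≗ (λ j → trans (cong ∣_∣ (starRow-other (punchInᵢ≢i i₀ j))) (∣⁅x⁆∣≡1 (zero {2 + ℓ}))) ⟩
      ∑[ j < m ] 1                          ≡⟨ ∑-const m 1 ⟩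
      m * 1                                 ≡⟨ *-identityʳ m ⟩
      m                                     ∎

  ∈D : ∀ {i j} → j ∈ starRow i → combine i j ∈ D
  ∈D {i} {j} = ∈-by-lookup (sym (lookup-fromRows starRow i j))

  ∈D⁻ : ∀ {i j} → combine i j ∈ D → j ∈ starRow i
  ∈D⁻ {i} {j} = ∈-by-lookup (lookup-fromRows starRow i j)

  centre∈D : ∀ {i} → i ≢ i₀ → combine i zero ∈ D
  centre∈D {i} i≢i₀ = ∈D {i} {zero} (subst (zero ∈_) (sym (starRow-other i≢i₀)) (x∈⁅x⁆ zero))

  ∈D-i₀ : ∀ {j} → j ∈ outside ∷ inside ∷ p → combine i₀ j ∈ D
  ∈D-i₀ {j} = ∈D {i₀} {j} ∘ subst (j ∈_) (sym starRow-i₀)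

  ∈D-i₀⁻ : ∀ {j} → combine i₀ j ∈ D → j ∈ outside ∷ inside ∷ p
  ∈D-i₀⁻ {j} = subst (j ∈_) starRow-i₀ ∘ ∈D⁻ {i₀} {j}

  ∈laterLeaves : ∀ {j} → combine i₀ (suc (suc j)) ∈ Z → j ∈ p
  ∈laterLeaves {j} = ∈-by-lookup (sym (lookup∘tabulate (λ j → lookup Z (combine i₀ (suc (suc j)))) j))

  D-dominates-Z : Dominates G D Z
  D-dominates-Z z z∈Z with cellOf {suc m} (3 + ℓ) z
  ... | cell i j with i ≟ i₀ | j
  ...   | no i≢i₀ | zero  = inj₁ (centre∈D i≢i₀)
  ...   | no i≢i₀ | suc a = inj₂ (_ , centre∈D i≢i₀ , centre~leaf i a)
  ...   | yes refl | zero         = inj₂ (_ , ∈D-i₀ {suc zero} (there here) , leaf~centre i₀ zero)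
  ...   | yes refl | suc zero     = inj₁ (∈D-i₀ {suc zero} (there here))
  ...   | yes refl | suc (suc j′) = inj₁ (∈D-i₀ {suc (suc j′)} (there (there (∈laterLeaves z∈Z))))

  D-misses : ∀ {j} → j ∉ p → ¬ Dominates G D ⊤
  D-misses {j} j∉p dom with dom (combine i₀ (suc (suc j))) ∈⊤
  ... | inj₁ leaf∈D = j∉p (drop-there (drop-there (∈D-i₀⁻ {suc (suc j)} leaf∈D)))
  ... | inj₂ (d , d∈D , d~leaf)
      with leaf-neighbour {i = i₀} {suc j} {d} (Adj-sym {G} {d} {combine i₀ (suc (suc j))} d~leaf)
  ...   | refl with ∈D-i₀⁻ {zero} d∈D
  ...     | ()

  ¬core : ∀ {k} → suc m + ℓ ≤ k → ∣ p ∣ < suc ℓ → ¬ IsDominationCore G k Z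
  ¬core {k} m+ℓ≤k ∣p∣<1+ℓ core with ∣p∣<n⇒∃∉ p ∣p∣<1+ℓ
  ... | j , j∉p = D-misses j∉p (core D ∣D∣≤k D-dominates-Z)
    where
    open ≤-Reasoning
    ∣D∣≤k : ∣ D ∣ ≤ k
    ∣D∣≤k = begin
      ∣ D ∣          ≡⟨ ∣D∣ ⟩
      suc ∣ p ∣ + m  ≤⟨ +-monoˡ-≤ m ∣p∣<1+ℓ ⟩
      suc ℓ + m      ≡⟨ cong suc (+-comm ℓ m) ⟩
      suc m + ℓ      ≤⟨ m+ℓ≤k ⟩
      k              ∎

Stars-domination-core-≥ : ∀ m ℓ {k} → m + ℓ ≤ k →
                          ∀ Z → IsDominationCore (Stars m (2 + ℓ)) k Z → m * suc ℓ ≤ ∣ Z ∣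
Stars-domination-core-≥ zero    ℓ _     _ _    = z≤n
Stars-domination-core-≥ (suc m) ℓ m+ℓ≤k Z core with all? (λ i → suc ℓ ≤? ∣ laterLeaves Z i ∣)
... | yes full = begin
  suc m * suc ℓ                 ≡⟨ sym (∑-const (suc m) (suc ℓ)) ⟩
  ∑[ i < suc m ] suc ℓ          ≤⟨ ∑-mono-≤ (λ i → ≤-trans (full i) (∣laterLeaves∣≤∣row∣ Z i)) ⟩
  ∑[ i < suc m ] ∣ row Z i ∣    ≡⟨ sym (∣p∣≡∑∣row∣ (suc m) Z) ⟩
  ∣ Z ∣                         ∎
  where open ≤-Reasoning
... | no ¬full with ¬∀⟶∃¬ (suc m) _ (λ i → suc ℓ ≤? ∣ laterLeaves Z i ∣) ¬full
...   | i₀ , few = contradiction core (BadStar.¬core Z i₀ m+ℓ≤k (≰⇒> few))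

⌈n/2⌉≤1+⌊n/2⌋ : ∀ n → ⌈ n /2⌉ ≤ suc ⌊ n /2⌋
⌈n/2⌉≤1+⌊n/2⌋ zero          = z≤n
⌈n/2⌉≤1+⌊n/2⌋ (suc zero)    = s≤s z≤n
⌈n/2⌉≤1+⌊n/2⌋ (suc (suc n)) = s≤s (⌈n/2⌉≤1+⌊n/2⌋ n)

square≤4*⌈n/2⌉*[1+⌊n/2⌋] : ∀ n → n * n ≤ 4 * (⌈ n /2⌉ * suc ⌊ n /2⌋)
square≤4*⌈n/2⌉*[1+⌊n/2⌋] n = begin
  n * n                        ≤⟨ *-mono-≤ n≤c+c n≤c+c ⟩
  (c + c) * (c + c)            ≡⟨ double-square c ⟩
  4 * (c * c)                  ≤⟨ *-monoʳ-≤ 4 (*-monoʳ-≤ c (⌈n/2⌉≤1+⌊n/2⌋ n)) ⟩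
  4 * (c * suc ⌊ n /2⌋)        ∎
  where
  open ≤-Reasoning
  c = ⌈ n /2⌉
  n≤c+c : n ≤ c + c
  n≤c+c = subst (_≤ c + c) (⌊n/2⌋+⌈n/2⌉≡n n) (+-monoˡ-≤ c (⌊n/2⌋≤⌈n/2⌉ n))
  double-square : ∀ x → (x + x) * (x + x) ≡ 4 * (x * x)
  double-square = solve-∀

lemma28 : ∃[ 𝒞 ] (BoundedExpansion 𝒞 ×
            ∃[ c ] ∃[ k₀ ] (∀ (k : ℕ) → k ≥ k₀ →
              ∃[ G ] (𝒞 G × (∀ Z → IsDominationCore G k Z → k * k ≤ c * ∣ Z ∣))))
lemma28 = StarForest , starForest-boundedExpansion , 4 , 0 , λ k _ →
  Stars ⌈ k /2⌉ (2 + ⌊ k /2⌋) , stars-starForest {⌈ k /2⌉} , λ Z core → begin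
    k * k
      ≤⟨ square≤4*⌈n/2⌉*[1+⌊n/2⌋] k ⟩
    4 * (⌈ k /2⌉ * suc ⌊ k /2⌋)
      ≤⟨ *-monoʳ-≤ 4 (Stars-domination-core-≥ ⌈ k /2⌉ ⌊ k /2⌋ ⌈k/2⌉+⌊k/2⌋≤k Z core) ⟩
    4 * ∣ Z ∣ ∎
  where
  open ≤-Reasoning
  ⌈k/2⌉+⌊k/2⌋≤k : ∀ {k} → ⌈ k /2⌉ + ⌊ k /2⌋ ≤ k
  ⌈k/2⌉+⌊k/2⌋≤k {k} = ≤-reflexive (trans (+-comm ⌈ k /2⌉ ⌊ k /2⌋) (⌊n/2⌋+⌈n/2⌉≡n k))
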